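{- Let $\Gamma$ be an edge-weighted graph, $i\neq j$ two vertices of $\Gamma$, and $t$ a positive integer. If the edge-weighted graph $\Gamma[i,j;t]$ is positive, then so is $\Gamma[i,j;1]$.
   Context: An edge-weighted graph is a finite simple graph with a positive integer weight on each edge. $\Gamma[i,j;t]$ denotes the edge-weighted graph obtained from $\Gamma$ by adjoining $t$ new vertices $i_1,\dots,i_t$ and $t+1$ new edges $\{i,i_1\},\{i_1,i_2\},\dots,\{i_{t-1},i_t\},\{i_t,j\}$, all of weight $1$. A quasi-Cartan matrix is a square integer matrix $A$ with diagonal entries $2$ such that $DA$ is symmetric for some diagonal $D$ with positive diagonal entries; it is positive if $DA$ is positive definite. Its diagram $\Gamma(A)$ has vertices the indices, an edge $\{i,j\}$ for each $i\ne j$ with $A_{ij}\ne0$, of weight $A_{ij}A_{ji}$ and sign $-\operatorname{sgn}(A_{ij})$. An edge-weighted graph is positive if some assignment of signs to its edges makes it the diagram of a positive quasi-Cartan matrix.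
   Formalization: The diagonal matrix D has rational entries, and positive definiteness of DA is tested on rational vectors. -}

module Defs where

open import Data.Nat as ℕ using (ℕ; zero; suc)
open import Data.Fin as Fin using (Fin; zero; suc; toℕ; fromℕ; splitAt; _↑ˡ_; _↑ʳ_)
open import Data.Fin.Properties using () renaming (_≟_ to _≟F_)
open import Data.Integer as ℤ using (ℤ; sign)
open import Data.Rational as ℚ using (ℚ; 0ℚ)
open import Data.Sign as Sign using (Sign)
open import Data.Sum using (_⊎_; inj₁; inj₂)
open import Data.Product using (Σ; ∃; _×_; _,_)
open import Relation.Binary.PropositionalEquality using (_≡_; _≢_)
open import Relation.Nullary using (¬_; yes; no)
open import Relation.Nullary.Decidable using (⌊_⌋)
open import Data.Bool using (Bool; true; false; _∨_; _∧_; if_then_else_)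
open import Function.Bundles using (_⇔_)

-- Encoded by a symmetric weight
-- function with zero diagonal; weight 0 means "no edge", and a positive
-- value w means "an edge of weight w".

record EWGraph : Set where
  field
    n      : ℕ
    weight : Fin n → Fin n → ℕ
    sym    : ∀ a b → weight a b ≡ weight b a
    loopless : ∀ a → weight a a ≡ 0

open EWGraph public

IsEdge : (Γ : EWGraph) → Fin (n Γ) → Fin (n Γ) → Set
IsEdge Γ a b = weight Γ a b ≢ 0

-- Γ[i,j;t] for t = suc s ≥ 1.  Vertex set Fin (n + t): the old vertex a is
-- a ↑ˡ t, the new vertex i_{k+1} (k : Fin t) is n ↑ʳ k.  New edges
-- {i,i_1}, {i_k,i_{k+1}}, {i_t,j}, all of weight 1.

private
  b2n : Bool → ℕ
  b2n true  = 1
  b2n false = 0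

  _==_ : ∀ {m} → Fin m → Fin m → Bool
  a == b = ⌊ a ≟F b ⌋

  _==ℕ_ : ℕ → ℕ → Bool
  a ==ℕ b = a ℕ.≡ᵇ b

-- weight between old vertex a and new vertex k (index k : Fin (suc s),
-- k = 0 is i_1 and k = s is i_t)
oldNew : ∀ {m s} → Fin m → Fin m → Fin m → Fin (suc s) → ℕ
oldNew {s = s} i j a k = b2n (((a == i) ∧ (k == zero)) ∨ ((a == j) ∧ (k == fromℕ s)))

newNew : ∀ {s} → Fin (suc s) → Fin (suc s) → ℕ
newNew k l = b2n ((toℕ l ==ℕ suc (toℕ k)) ∨ (toℕ k ==ℕ suc (toℕ l)))

extWeight : (Γ : EWGraph) → Fin (n Γ) → Fin (n Γ) → (s : ℕ) →
            Fin (n Γ ℕ.+ suc s) → Fin (n Γ ℕ.+ suc s) → ℕ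
extWeight Γ i j s x y with splitAt (n Γ) x | splitAt (n Γ) y
... | inj₁ a | inj₁ b = weight Γ a b
... | inj₁ a | inj₂ l = oldNew i j a l
... | inj₂ k | inj₁ b = oldNew i j b k
... | inj₂ k | inj₂ l = newNew k l

open import Relation.Binary.PropositionalEquality using (refl; cong)
open import Data.Bool.Properties using (∨-comm)

private
  newNew-sym : ∀ {s} (k l : Fin (suc s)) → newNew k l ≡ newNew l k
  newNew-sym k l = cong b2n (∨-comm (toℕ l ==ℕ suc (toℕ k)) (toℕ k ==ℕ suc (toℕ l)))

  ==ℕ-suc : ∀ m → (m ==ℕ suc m) ≡ false
  ==ℕ-suc zero = refl
  ==ℕ-suc (suc m) = ==ℕ-suc m

  newNew-loop : ∀ {s} (k : Fin (suc s)) → newNew k k ≡ 0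
  newNew-loop k rewrite ==ℕ-suc (toℕ k) = refl

extSym : (Γ : EWGraph) (i j : Fin (n Γ)) (s : ℕ) → ∀ x y → extWeight Γ i j s x y ≡ extWeight Γ i j s y x
extSym Γ i j s x y with splitAt (n Γ) x | splitAt (n Γ) y
... | inj₁ a | inj₁ b = sym Γ a b
... | inj₁ a | inj₂ l = refl
... | inj₂ k | inj₁ b = refl
... | inj₂ k | inj₂ l = newNew-sym k l

extLoop : (Γ : EWGraph) (i j : Fin (n Γ)) (s : ℕ) → ∀ x → extWeight Γ i j s x x ≡ 0
extLoop Γ i j s x with splitAt (n Γ) x
... | inj₁ a = loopless Γ a
... | inj₂ k = newNew-loop k

subdivide : (Γ : EWGraph) → Fin (n Γ) → Fin (n Γ) → (t : ℕ) → .{{ℕ.NonZero t}} → EWGraph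
subdivide Γ i j (suc s) = record
  { n = n Γ ℕ.+ suc s
  ; weight = extWeight Γ i j s
  ; sym = extSym Γ i j s
  ; loopless = extLoop Γ i j s }

Matrix : ℕ → Set
Matrix m = Fin m → Fin m → ℤ

sumℚ : ∀ {m} → (Fin m → ℚ) → ℚ
sumℚ {zero}  f = 0ℚ
sumℚ {suc m} f = f zero ℚ.+ sumℚ (λ k → f (suc k))

PositiveDefinite : ∀ {m} → (Fin m → Fin m → ℚ) → Set
PositiveDefinite {m} M =
  ∀ (x : Fin m → ℚ) → (∃ λ k → x k ≢ 0ℚ) →
  0ℚ ℚ.< sumℚ (λ a → sumℚ (λ b → x a ℚ.* M a b ℚ.* x b))

-- D A for a diagonal matrix D = diag(d)
diagMul : ∀ {m} → (Fin m → ℚ) → Matrix m → Fin m → Fin m → ℚ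
diagMul d A a b = d a ℚ.* (A a b ℚ./ 1)

IsSymmetric : ∀ {m} → (Fin m → Fin m → ℚ) → Set
IsSymmetric M = ∀ a b → M a b ≡ M b a

Symmetrizer : ∀ {m} → Matrix m → (Fin m → ℚ) → Set
Symmetrizer A d = (∀ a → 0ℚ ℚ.< d a) × IsSymmetric (diagMul d A)

IsQuasiCartan : ∀ {m} → Matrix m → Set
IsQuasiCartan A = (∀ a → A a a ≡ ℤ.+ 2) × ∃ λ d → Symmetrizer A d

IsPositiveQuasiCartan : ∀ {m} → Matrix m → Set
IsPositiveQuasiCartan A =
  (∀ a → A a a ≡ ℤ.+ 2) × ∃ λ d → Symmetrizer A d × PositiveDefinite (diagMul d A)

-- A sign assignment on the edges of Γ is a symmetric function
-- σ : Fin n → Fin n → Sign (only its values on edges matter).  Γ with σ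
-- is the diagram Γ(A) of A when: the vertices agree (both Fin n), for
-- a ≢ b there is an edge {a,b} iff A a b ≢ 0, its weight is
-- A a b * A b a and its sign is − sgn(A a b).

SignAssignment : EWGraph → Set
SignAssignment Γ = Σ (Fin (n Γ) → Fin (n Γ) → Sign) λ σ → ∀ a b → σ a b ≡ σ b a

IsDiagramOf : (Γ : EWGraph) → SignAssignment Γ → Matrix (n Γ) → Set
IsDiagramOf Γ (σ , _) A =
  ∀ a b → a ≢ b →
    ((A a b ≢ ℤ.0ℤ) ⇔ IsEdge Γ a b)
    × (A a b ℤ.* A b a ≡ ℤ.+ weight Γ a b)
    × (IsEdge Γ a b → σ a b ≡ Sign.opposite (sign (A a b)))

IsPositive : EWGraph → Set
IsPositive Γ = ∃ λ (σ : SignAssignment Γ) → ∃ λ (A : Matrix (n Γ)) →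
  IsPositiveQuasiCartan A × IsDiagramOf Γ σ A

module Submission where

-- Let A be a positive quasi-Cartan matrix with diagram Γ[i,j;t], symmetrised by D = diag(d).
-- On the new vertices i₁ … i_t, A is a path block with entries ±1 next to the diagonal, so the
-- signs c₁ = 1, c_{k+1} = −A(i_k,i_{k+1}) c_k give cᵀ A c = 2, and d is constant along the path.
-- Merging the path along c, i.e. A′ = Pᵀ A P for P = diag(I, c), yields an integer matrix with
-- diagonal 2, symmetrised by d restricted to the old vertices together with d(i₁), and positive
-- definite because P is injective. Only i and j are joined to the path, to its two ends, with
-- weight 1, so the diagram of A′ is Γ[i,j;1].

open import Defs hiding (sym)
open import Algebra.Bundles using (Semiring; CommutativeRing)
open import Data.Nat as ℕ using (ℕ; zero; suc; NonZero)
import Data.Nat.Properties as ℕ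
open import Data.Fin using (Fin; zero; suc; toℕ; fromℕ; _↑ˡ_; _↑ʳ_; splitAt; punchIn)
open import Data.Fin.Properties
  using (_≟_; suc-injective; punchInᵢ≢i; ↑ˡ-injective; ↑ʳ-injective;
         splitAt-↑ˡ; splitAt-↑ʳ; splitAt⁻¹-↑ˡ; splitAt⁻¹-↑ʳ)
open import Data.Integer as ℤ using (ℤ; +_; +[1+_]; -[1+_]; 0ℤ; 1ℤ; -1ℤ; sign)
import Data.Integer.Properties as ℤ
open import Data.Integer.Tactic.RingSolver using (solve-∀)
open import Data.Rational as ℚ using (ℚ; 0ℚ; 1ℚ; 1/_)
import Data.Rational.Properties as ℚ
open import Data.Rational.Solver using (module +-*-Solver)
import Data.Rational.Unnormalised as ℚᵘ
import Data.Rational.Unnormalised.Properties as ℚᵘ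
open import Data.Sign as Sign using (Sign)
open import Data.Bool as Bool using (true; false)
open import Data.Empty using (⊥-elim)
open import Data.Product using (∃; _×_; _,_; proj₁; proj₂)
open import Data.Sum using (_⊎_; inj₁; inj₂)
open import Data.Vec.Functional using (_++_)
open import Data.Vec.Functional.Properties using (lookup-++ˡ; lookup-++ʳ)
open import Function using (_∘_; case_of_; mk⇔; Equivalence)
open import Relation.Binary.PropositionalEquality
  using (_≡_; _≢_; refl; sym; trans; cong; cong₂; cong-app; subst; module ≡-Reasoning)
open import Relation.Nullary using (Dec; yes; no; contradiction)
open import Relation.Nullary.Decidable using (decidable-stable; dec-yes; dec-no)

open +-*-Solver using (solve; _:*_; _:=_)

module SemiringSum {c ℓ} (R : Semiring c ℓ) where

  open Semiring R renaming (sym to ≈-sym; trans to ≈-trans)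
  open import Algebra.Properties.Semiring.Sum R public
  open import Relation.Binary.Reasoning.Setoid setoid

  sum-zero : ∀ {n} (f : Fin n → Carrier) → (∀ k → f k ≈ 0#) → sum f ≈ 0#
  sum-zero {n} f f≈0 = ≈-trans (sum-cong-≋ f≈0) (sum-replicate-zero n)

  sum-single : ∀ {n} (f : Fin (suc n) → Carrier) k → (∀ l → l ≢ k → f l ≈ 0#) → sum f ≈ f k
  sum-single f k f≈0 = begin
    sum f                      ≈⟨ sum-remove {i = k} f ⟩
    f k + sum (f ∘ punchIn k)  ≈⟨ +-congˡ (sum-zero _ (λ l → f≈0 _ (punchInᵢ≢i k l))) ⟩
    f k + 0#                   ≈⟨ +-identityʳ (f k) ⟩
    f k                        ∎

  sum-↑ : ∀ m {n} (f : Fin (m ℕ.+ n) → Carrier) → sum f ≈ sum (f ∘ (_↑ˡ n)) + sum (f ∘ (m ↑ʳ_))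
  sum-↑ zero    f = ≈-sym (+-identityˡ _)
  sum-↑ (suc m) f = ≈-trans (+-congˡ (sum-↑ m (f ∘ suc))) (≈-sym (+-assoc _ _ _))

  sum²-↑ : ∀ m {n} (h : Fin (m ℕ.+ n) → Fin (m ℕ.+ n) → Carrier) →
           sum (λ u → sum (h u)) ≈
             (sum (λ a → sum (λ b → h (a ↑ˡ n) (b ↑ˡ n))) + sum (λ k → sum (λ b → h (m ↑ʳ k) (b ↑ˡ n))))
           + (sum (λ a → sum (λ l → h (a ↑ˡ n) (m ↑ʳ l))) + sum (λ k → sum (λ l → h (m ↑ʳ k) (m ↑ʳ l))))
  sum²-↑ m {n} h = begin
    sum (λ u → sum (h u))
      ≈⟨ sum-cong-≋ (λ u → sum-↑ m (h u)) ⟩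
    sum (λ u → sum (λ b → h u (b ↑ˡ n)) + sum (λ l → h u (m ↑ʳ l)))
      ≈⟨ ∑-distrib-+ (λ u → sum (λ b → h u (b ↑ˡ n))) (λ u → sum (λ l → h u (m ↑ʳ l))) ⟩
    sum (λ u → sum (λ b → h u (b ↑ˡ n))) + sum (λ u → sum (λ l → h u (m ↑ʳ l)))
      ≈⟨ +-cong (sum-↑ m _) (sum-↑ m _) ⟩
    _ ∎

  *-distrib-sum : ∀ {n} x (f : Fin n → Carrier) y → x * sum f * y ≈ sum (λ k → x * f k * y)
  *-distrib-sum x f y = ≈-trans (*-congʳ (*-distribˡ-sum x f)) (*-distribʳ-sum y (λ k → x * f k))

module ℤΣ = SemiringSum ℤ.+-*-semiring
module ℚΣ = SemiringSum (CommutativeRing.semiring ℚ.+-*-commutativeRing)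

data Split (m : ℕ) {n : ℕ} : Fin (m ℕ.+ n) → Set where
  inˡ : ∀ a → Split m (a ↑ˡ n)
  inʳ : ∀ k → Split m (m ↑ʳ k)

split : ∀ m {n} p → Split m {n} p
split m p with splitAt m p in eq
... | inj₁ a = subst (Split m) (splitAt⁻¹-↑ˡ eq) (inˡ a)
... | inj₂ k = subst (Split m) (splitAt⁻¹-↑ʳ eq) (inʳ k)

↑ˡ≢↑ʳ : ∀ {m n} (a : Fin m) (k : Fin n) → a ↑ˡ n ≢ m ↑ʳ k
↑ˡ≢↑ʳ {m} {n} a k eq with trans (sym (splitAt-↑ˡ m a n)) (trans (cong (splitAt m) eq) (splitAt-↑ʳ m n k))
... | ()

module Blocks {m n} {X : Set} (P : Fin m → Fin m → X) (Q : Fin m → Fin n → X)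
         (R : Fin n → Fin m → X) (S : Fin n → Fin n → X) where

  blocks : Fin (m ℕ.+ n) → Fin (m ℕ.+ n) → X
  blocks = (λ a → P a ++ Q a) ++ (λ k → R k ++ S k)

  private
    rows-↑ˡ : ∀ a → blocks (a ↑ˡ n) ≡ P a ++ Q a
    rows-↑ˡ = lookup-++ˡ (λ a → P a ++ Q a) (λ k → R k ++ S k)

    rows-↑ʳ : ∀ k → blocks (m ↑ʳ k) ≡ R k ++ S k
    rows-↑ʳ = lookup-++ʳ (λ a → P a ++ Q a) (λ k → R k ++ S k)

  blocks-↑ˡ-↑ˡ : ∀ a b → blocks (a ↑ˡ n) (b ↑ˡ n) ≡ P a b
  blocks-↑ˡ-↑ˡ a b = trans (cong-app (rows-↑ˡ a) (b ↑ˡ n)) (lookup-++ˡ (P a) (Q a) b)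

  blocks-↑ˡ-↑ʳ : ∀ a l → blocks (a ↑ˡ n) (m ↑ʳ l) ≡ Q a l
  blocks-↑ˡ-↑ʳ a l = trans (cong-app (rows-↑ˡ a) (m ↑ʳ l)) (lookup-++ʳ (P a) (Q a) l)

  blocks-↑ʳ-↑ˡ : ∀ k b → blocks (m ↑ʳ k) (b ↑ˡ n) ≡ R k b
  blocks-↑ʳ-↑ˡ k b = trans (cong-app (rows-↑ʳ k) (b ↑ˡ n)) (lookup-++ˡ (R k) (S k) b)

  blocks-↑ʳ-↑ʳ : ∀ k l → blocks (m ↑ʳ k) (m ↑ʳ l) ≡ S k l
  blocks-↑ʳ-↑ʳ k l = trans (cong-app (rows-↑ʳ k) (m ↑ʳ l)) (lookup-++ʳ (R k) (S k) l)

module _ where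
  open import Data.Integer using (_*_)

  ∣i∣≡1⇒i≡±1 : ∀ i → ℤ.∣ i ∣ ≡ 1 → i ≡ 1ℤ ⊎ i ≡ -1ℤ
  ∣i∣≡1⇒i≡±1 (+ .1)   refl = inj₁ refl
  ∣i∣≡1⇒i≡±1 -[1+ 0 ] refl = inj₂ refl

  i*j≡1⇒i≡j : ∀ i j → i * j ≡ 1ℤ → i ≡ j
  i*j≡1⇒i≡j i j ij≡1
    with ∣i∣≡1⇒i≡±1 i (ℕ.m*n≡1⇒m≡1 ℤ.∣ i ∣ ℤ.∣ j ∣ ∣i∣*∣j∣≡1)
       | ∣i∣≡1⇒i≡±1 j (ℕ.m*n≡1⇒n≡1 ℤ.∣ i ∣ ℤ.∣ j ∣ ∣i∣*∣j∣≡1)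
    where ∣i∣*∣j∣≡1 : ℤ.∣ i ∣ ℕ.* ℤ.∣ j ∣ ≡ 1
          ∣i∣*∣j∣≡1 = trans (sym (ℤ.abs-* i j)) (cong ℤ.∣_∣ ij≡1)
  ... | inj₁ refl | inj₁ refl = refl
  ... | inj₂ refl | inj₂ refl = refl
  ... | inj₁ refl | inj₂ refl = case ij≡1 of λ ()
  ... | inj₂ refl | inj₁ refl = case ij≡1 of λ ()

  *≡+⇒sign≡ : ∀ i j {w} → i * j ≡ + w → (i ≡ 0ℤ → j ≡ 0ℤ) → (j ≡ 0ℤ → i ≡ 0ℤ) →
              sign i ≡ sign j
  *≡+⇒sign≡ (+ 0)    (+ 0)    _  _    _    = refl
  *≡+⇒sign≡ (+ 0)    +[1+ n ] _  i≡0⇒ _    = contradiction (i≡0⇒ refl) λ ()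
  *≡+⇒sign≡ (+ 0)    -[1+ n ] _  i≡0⇒ _    = contradiction (i≡0⇒ refl) λ ()
  *≡+⇒sign≡ +[1+ m ] (+ 0)    _  _    j≡0⇒ = contradiction (j≡0⇒ refl) λ ()
  *≡+⇒sign≡ -[1+ m ] (+ 0)    _  _    j≡0⇒ = contradiction (j≡0⇒ refl) λ ()
  *≡+⇒sign≡ +[1+ m ] +[1+ n ] _  _    _    = refl
  *≡+⇒sign≡ -[1+ m ] -[1+ n ] _  _    _    = refl
  *≡+⇒sign≡ +[1+ m ] -[1+ n ] () _    _
  *≡+⇒sign≡ -[1+ m ] +[1+ n ] () _    _

fromℤ : ℤ → ℚ
fromℤ i = i ℚ./ 1

toℚᵘ-fromℤ : ∀ i → ℚ.toℚᵘ (fromℤ i) ℚᵘ.≃ ℚᵘ.mkℚᵘ i 0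
toℚᵘ-fromℤ i = ℚ.toℚᵘ-fromℚᵘ (ℚᵘ.mkℚᵘ i 0)

fromℤ-+ : ∀ i j → fromℤ (i ℤ.+ j) ≡ fromℤ i ℚ.+ fromℤ j
fromℤ-+ i j = ℚ.toℚᵘ-injective (begin
  ℚ.toℚᵘ (fromℤ (i ℤ.+ j))                 ≈⟨ toℚᵘ-fromℤ (i ℤ.+ j) ⟩
  ℚᵘ.mkℚᵘ (i ℤ.+ j) 0                      ≈⟨ ℚᵘ.*≡* (cong (ℤ._* 1ℤ) (sym i*1+j*1≡i+j)) ⟩
  ℚᵘ.mkℚᵘ i 0 ℚᵘ.+ ℚᵘ.mkℚᵘ j 0             ≈⟨ ℚᵘ.+-cong (toℚᵘ-fromℤ i) (toℚᵘ-fromℤ j) ⟨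
  ℚ.toℚᵘ (fromℤ i) ℚᵘ.+ ℚ.toℚᵘ (fromℤ j)   ≈⟨ ℚ.toℚᵘ-homo-+ (fromℤ i) (fromℤ j) ⟨
  ℚ.toℚᵘ (fromℤ i ℚ.+ fromℤ j)             ∎)
  where
  open import Relation.Binary.Reasoning.Setoid ℚᵘ.≃-setoid
  i*1+j*1≡i+j : i ℤ.* 1ℤ ℤ.+ j ℤ.* 1ℤ ≡ i ℤ.+ j
  i*1+j*1≡i+j = cong₂ ℤ._+_ (ℤ.*-identityʳ i) (ℤ.*-identityʳ j)

fromℤ-* : ∀ i j → fromℤ (i ℤ.* j) ≡ fromℤ i ℚ.* fromℤ j
fromℤ-* i j = ℚ.toℚᵘ-injective (begin
  ℚ.toℚᵘ (fromℤ (i ℤ.* j))                 ≈⟨ toℚᵘ-fromℤ (i ℤ.* j) ⟩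
  ℚᵘ.mkℚᵘ (i ℤ.* j) 0                      ≈⟨ ℚᵘ.*≡* refl ⟩
  ℚᵘ.mkℚᵘ i 0 ℚᵘ.* ℚᵘ.mkℚᵘ j 0             ≈⟨ ℚᵘ.*-cong (toℚᵘ-fromℤ i) (toℚᵘ-fromℤ j) ⟨
  ℚ.toℚᵘ (fromℤ i) ℚᵘ.* ℚ.toℚᵘ (fromℤ j)   ≈⟨ ℚ.toℚᵘ-homo-* (fromℤ i) (fromℤ j) ⟨
  ℚ.toℚᵘ (fromℤ i ℚ.* fromℤ j)             ∎)
  where open import Relation.Binary.Reasoning.Setoid ℚᵘ.≃-setoid

fromℤ-sum : ∀ {n} (f : Fin n → ℤ) → fromℤ (ℤΣ.sum f) ≡ ℚΣ.sum (fromℤ ∘ f)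
fromℤ-sum {zero}  f = refl
fromℤ-sum {suc n} f = trans (fromℤ-+ (f zero) _) (cong (fromℤ (f zero) ℚ.+_) (fromℤ-sum (f ∘ suc)))

module _ where
  open import Data.Rational using (_*_)

  *-cancelʳ-involutive : ∀ {p q r} → r * r ≡ 1ℚ → p * r ≡ q * r → p ≡ q
  *-cancelʳ-involutive {p} {q} {r} r²≡1 pr≡qr = begin
    p            ≡⟨ ℚ.*-identityʳ p ⟨
    p * 1ℚ       ≡⟨ cong (p *_) r²≡1 ⟨
    p * (r * r)  ≡⟨ ℚ.*-assoc p r r ⟨
    p * r * r    ≡⟨ cong (_* r) pr≡qr ⟩
    q * r * r    ≡⟨ ℚ.*-assoc q r r ⟩
    q * (r * r)  ≡⟨ cong (q *_) r²≡1 ⟩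
    q * 1ℚ       ≡⟨ ℚ.*-identityʳ q ⟩
    q            ∎
    where open ≡-Reasoning

  *-≢0 : ∀ {p q} → p ≢ 0ℚ → q ≢ 0ℚ → p * q ≢ 0ℚ
  *-≢0 {p} {q} p≢0 q≢0 pq≡0 = q≢0 (begin
    q                ≡⟨ ℚ.*-identityˡ q ⟨
    1ℚ * q           ≡⟨ cong (_* q) (ℚ.*-inverseˡ p) ⟨
    (1/ p) * p * q   ≡⟨ ℚ.*-assoc (1/ p) p q ⟩
    (1/ p) * (p * q) ≡⟨ cong ((1/ p) *_) pq≡0 ⟩
    (1/ p) * 0ℚ      ≡⟨ ℚ.*-zeroʳ (1/ p) ⟩
    0ℚ               ∎)
    where
    open ≡-Reasoning
    instance
      p-nonZero : ℚ.NonZero p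
      p-nonZero = ℚ.≢-nonZero p≢0

-- Simply-laced paths

tail² : ∀ {n} {A : Set} → (Fin (suc n) → Fin (suc n) → A) → Fin n → Fin n → A
tail² f k l = f (suc k) (suc l)

module _ where
  open import Data.Integer using (_+_; _*_; -_)

  record IsSimplyLacedPath {n} (f : Fin n → Fin n → ℤ) : Set where
    field
      diagonal    : ∀ k → f k k ≡ + 2
      adjacent    : ∀ k l → toℕ l ≡ suc (toℕ k) → f k l * f l k ≡ 1ℤ
      nonadjacent : ∀ k l → k ≢ l → toℕ l ≢ suc (toℕ k) → toℕ k ≢ suc (toℕ l) → f k l ≡ 0ℤ

  -- With these signs every vertex of the path contributes 2 to cᵀ f c and every edge −1.
  pathSigns : ∀ {n} → (Fin n → Fin n → ℤ) → Fin n → ℤ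
  pathSigns f zero = 1ℤ
  pathSigns {suc (suc n)} f (suc k) = - f zero (suc zero) * pathSigns (tail² f) k

  pathQuadratic : ∀ {n} → (Fin n → Fin n → ℤ) → ℤ
  pathQuadratic f = ℤΣ.sum (λ k → ℤΣ.sum (λ l → pathSigns f k * f k l * pathSigns f l))

  module _ {n} {f : Fin (suc (suc n)) → Fin (suc (suc n)) → ℤ} (P : IsSimplyLacedPath f) where
    open IsSimplyLacedPath P
    open ≡-Reasoning

    private
      α : ℤ
      α = f zero (suc zero)

      c : Fin (suc (suc n)) → ℤ
      c = pathSigns f

    tail²-path : IsSimplyLacedPath (tail² f)
    tail²-path = record
      { diagonal    = diagonal ∘ suc
      ; adjacent    = λ k l l≡1+k → adjacent (suc k) (suc l) (cong suc l≡1+k)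
      ; nonadjacent = λ k l k≢l l≢1+k k≢1+l → nonadjacent (suc k) (suc l)
          (k≢l ∘ suc-injective) (l≢1+k ∘ ℕ.suc-injective) (k≢1+l ∘ ℕ.suc-injective)
      }

    first-edge-symmetric : α ≡ f (suc zero) zero
    first-edge-symmetric = i*j≡1⇒i≡j _ _ (adjacent zero (suc zero) refl)

    first-edge-square : α * α ≡ 1ℤ
    first-edge-square = trans (cong (α *_) first-edge-symmetric) (adjacent zero (suc zero) refl)

    first-row-quadratic : ℤΣ.sum (λ l → c zero * f zero (suc l) * c (suc l)) ≡ -1ℤ
    first-row-quadratic = begin
      ℤΣ.sum (λ l → c zero * f zero (suc l) * c (suc l))
        ≡⟨ ℤΣ.sum-single (λ l → c zero * f zero (suc l) * c (suc l)) zero (λ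
             { zero 0≢0 → contradiction refl 0≢0
             ; (suc l) _ → cong (λ x → 1ℤ * x * c (suc (suc l)))
                                (nonadjacent zero (suc (suc l)) (λ ()) (λ ()) (λ ())) }) ⟩
      1ℤ * α * (- α * 1ℤ)  ≡⟨ regroup α ⟩
      - (α * α)            ≡⟨ cong -_ first-edge-square ⟩
      -1ℤ                  ∎
      where regroup : ∀ a → 1ℤ * a * (- a * 1ℤ) ≡ - (a * a)
            regroup = solve-∀

    first-column-quadratic : ℤΣ.sum (λ k → c (suc k) * f (suc k) zero * c zero) ≡ -1ℤ
    first-column-quadratic = begin
      ℤΣ.sum (λ k → c (suc k) * f (suc k) zero * c zero)
        ≡⟨ ℤΣ.sum-single (λ k → c (suc k) * f (suc k) zero * c zero) zero (λ
             { zero 0≢0 → contradiction refl 0≢0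
             ; (suc k) _ → trans (cong (λ x → c (suc (suc k)) * x * 1ℤ)
                                       (nonadjacent (suc (suc k)) zero (λ ()) (λ ()) (λ ())))
                                 (trans (ℤ.*-identityʳ _) (ℤ.*-zeroʳ (c (suc (suc k))))) }) ⟩
      - α * 1ℤ * f (suc zero) zero * 1ℤ  ≡⟨ regroup α (f (suc zero) zero) ⟩
      - (α * f (suc zero) zero)          ≡⟨ cong -_ (adjacent zero (suc zero) refl) ⟩
      -1ℤ                                ∎
      where regroup : ∀ a b → - a * 1ℤ * b * 1ℤ ≡ - (a * b)
            regroup = solve-∀

    tail-quadratic : ℤΣ.sum (λ k → ℤΣ.sum (λ l → c (suc k) * f (suc k) (suc l) * c (suc l)))
                   ≡ pathQuadratic (tail² f)
    tail-quadratic = begin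
      ℤΣ.sum (λ k → ℤΣ.sum (λ l → c (suc k) * f (suc k) (suc l) * c (suc l)))
        ≡⟨ ℤΣ.sum-cong-≗ (λ k → ℤΣ.sum-cong-≗ (λ l → regroup α (c′ k) (tail² f k l) (c′ l))) ⟩
      ℤΣ.sum (λ k → ℤΣ.sum (λ l → (α * α) * (c′ k * tail² f k l * c′ l)))
        ≡⟨ ℤΣ.sum-cong-≗ (λ k → ℤΣ.*-distribˡ-sum (α * α) (λ l → c′ k * tail² f k l * c′ l)) ⟨
      ℤΣ.sum (λ k → (α * α) * ℤΣ.sum (λ l → c′ k * tail² f k l * c′ l))
        ≡⟨ ℤΣ.*-distribˡ-sum (α * α) (λ k → ℤΣ.sum (λ l → c′ k * tail² f k l * c′ l)) ⟨
      (α * α) * pathQuadratic (tail² f)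
        ≡⟨ cong (_* pathQuadratic (tail² f)) first-edge-square ⟩
      1ℤ * pathQuadratic (tail² f)
        ≡⟨ ℤ.*-identityˡ _ ⟩
      pathQuadratic (tail² f) ∎
      where
      c′ : Fin (suc n) → ℤ
      c′ = pathSigns (tail² f)
      regroup : ∀ a x y z → - a * x * y * (- a * z) ≡ (a * a) * (x * y * z)
      regroup = solve-∀

  pathSigns-square : ∀ {n} {f : Fin n → Fin n → ℤ} → IsSimplyLacedPath f →
                     ∀ k → pathSigns f k * pathSigns f k ≡ 1ℤ
  pathSigns-square P zero = refl
  pathSigns-square {suc (suc n)} {f} P (suc k) = begin
    (- α * c) * (- α * c)  ≡⟨ regroup α c ⟩
    (α * α) * (c * c)      ≡⟨ cong₂ _*_ (first-edge-square P) (pathSigns-square (tail²-path P) k) ⟩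
    1ℤ                     ∎
    where
    open ≡-Reasoning
    α c : ℤ
    α = f zero (suc zero)
    c = pathSigns (tail² f) k
    regroup : ∀ a c → (- a * c) * (- a * c) ≡ (a * a) * (c * c)
    regroup = solve-∀

  pathQuadratic≡2 : ∀ {n} {f : Fin (suc n) → Fin (suc n) → ℤ} → IsSimplyLacedPath f → pathQuadratic f ≡ + 2
  pathQuadratic≡2 {zero} P rewrite IsSimplyLacedPath.diagonal P zero = refl
  pathQuadratic≡2 {suc n} {f} P = begin
    (g zero zero + ℤΣ.sum (λ l → g zero (suc l)))
      + ℤΣ.sum (λ k → g (suc k) zero + ℤΣ.sum (λ l → g (suc k) (suc l)))
      ≡⟨ cong₂ _+_ (cong₂ _+_ corner (first-row-quadratic P))
                   (ℤΣ.∑-distrib-+ (λ k → g (suc k) zero) (λ k → ℤΣ.sum (λ l → g (suc k) (suc l)))) ⟩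
    (+ 2 + -1ℤ) + (ℤΣ.sum (λ k → g (suc k) zero) + ℤΣ.sum (λ k → ℤΣ.sum (λ l → g (suc k) (suc l))))
      ≡⟨ cong (_+_ 1ℤ) (cong₂ _+_ (first-column-quadratic P)
                                  (trans (tail-quadratic P) (pathQuadratic≡2 (tail²-path P)))) ⟩
    + 2 ∎
    where
    open ≡-Reasoning
    g : Fin (suc (suc n)) → Fin (suc (suc n)) → ℤ
    g k l = pathSigns f k * f k l * pathSigns f l

    corner : g zero zero ≡ + 2
    corner rewrite IsSimplyLacedPath.diagonal P zero = refl

symmetrizer-path-constant : ∀ {n} {f : Fin (suc n) → Fin (suc n) → ℤ} → IsSimplyLacedPath f →
  (d : Fin (suc n) → ℚ) → IsSymmetric (diagMul d f) → ∀ k → d k ≡ d zero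
symmetrizer-path-constant P d dA-sym zero = refl
symmetrizer-path-constant {suc n} {f} P d dA-sym (suc k) = trans
  (symmetrizer-path-constant (tail²-path P) (d ∘ suc) (λ k l → dA-sym (suc k) (suc l)) k)
  (*-cancelʳ-involutive a²≡1 d₁a≡d₀a)
  where
  α : ℤ
  α = f zero (suc zero)
  a : ℚ
  a = fromℤ α
  a²≡1 : a ℚ.* a ≡ 1ℚ
  a²≡1 = trans (sym (fromℤ-* α α)) (cong fromℤ (first-edge-square P))
  d₁a≡d₀a : d (suc zero) ℚ.* a ≡ d zero ℚ.* a
  d₁a≡d₀a = trans (cong (λ x → d (suc zero) ℚ.* fromℤ x) (first-edge-symmetric P)) (sym (dA-sym zero (suc zero)))

-- Contracting a block of a quadratic form

module _ where
  open import Data.Rational using (_+_; _*_; _<_)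
  open ℚΣ using (sum; sum-cong-≗)

  quadratic : ∀ {m} → (Fin m → Fin m → ℚ) → (Fin m → ℚ) → ℚ
  quadratic M x = sum (λ a → sum (λ b → x a * M a b * x b))

  sumℚ≡sum : ∀ {m} (f : Fin m → ℚ) → sumℚ f ≡ sum f
  sumℚ≡sum {zero}  f = refl
  sumℚ≡sum {suc m} f = cong (_+_ (f zero)) (sumℚ≡sum (f ∘ suc))

  sumℚ²≡quadratic : ∀ {m} (M : Fin m → Fin m → ℚ) x →
                    sumℚ (λ a → sumℚ (λ b → x a * M a b * x b)) ≡ quadratic M x
  sumℚ²≡quadratic M x = trans (sumℚ≡sum (λ a → sumℚ (λ b → x a * M a b * x b)))
                              (sum-cong-≗ (λ a → sumℚ≡sum (λ b → x a * M a b * x b)))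

  module _ {N T : ℕ} (c : Fin T → ℚ) where

    expand : (Fin (N ℕ.+ 1) → ℚ) → Fin (N ℕ.+ T) → ℚ
    expand x = (λ a → x (a ↑ˡ 1)) ++ (λ k → c k * x (N ↑ʳ zero))

    -- M′ = Pᵀ M P, where P : ℚ^(N+1) → ℚ^(N+T) is the identity on the first N coordinates and
    -- sends the last one along c (this is `expand`).
    record IsContraction (M : Fin (N ℕ.+ T) → Fin (N ℕ.+ T) → ℚ)
                         (M′ : Fin (N ℕ.+ 1) → Fin (N ℕ.+ 1) → ℚ) : Set where
      field
        old-old : ∀ a b → M′ (a ↑ˡ 1) (b ↑ˡ 1) ≡ M (a ↑ˡ T) (b ↑ˡ T)
        old-new : ∀ a → M′ (a ↑ˡ 1) (N ↑ʳ zero) ≡ sum (λ k → M (a ↑ˡ T) (N ↑ʳ k) * c k)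
        new-old : ∀ b → M′ (N ↑ʳ zero) (b ↑ˡ 1) ≡ sum (λ k → c k * M (N ↑ʳ k) (b ↑ˡ T))
        new-new : M′ (N ↑ʳ zero) (N ↑ʳ zero) ≡ sum (λ k → sum (λ l → c k * M (N ↑ʳ k) (N ↑ʳ l) * c l))

    module _ {M M′} (C : IsContraction M M′) (x : Fin (N ℕ.+ 1) → ℚ) where
      open IsContraction C
      open ≡-Reasoning

      private
        X : ℚ
        X = x (N ↑ʳ zero)

        y : Fin (N ℕ.+ T) → ℚ
        y = expand x

        y-old : ∀ a → y (a ↑ˡ T) ≡ x (a ↑ˡ 1)
        y-old = lookup-++ˡ (λ a → x (a ↑ˡ 1)) (λ k → c k * X)

        y-new : ∀ k → y (N ↑ʳ k) ≡ c k * X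
        y-new = lookup-++ʳ (λ a → x (a ↑ˡ 1)) (λ k → c k * X)

        old-old-term : ∀ a b → x (a ↑ˡ 1) * M′ (a ↑ˡ 1) (b ↑ˡ 1) * x (b ↑ˡ 1)
                             ≡ y (a ↑ˡ T) * M (a ↑ˡ T) (b ↑ˡ T) * y (b ↑ˡ T)
        old-old-term a b rewrite y-old a | y-old b | old-old a b = refl

        old-new-term : ∀ a k → x (a ↑ˡ 1) * (M (a ↑ˡ T) (N ↑ʳ k) * c k) * X
                             ≡ y (a ↑ˡ T) * M (a ↑ˡ T) (N ↑ʳ k) * y (N ↑ʳ k)
        old-new-term a k rewrite y-old a | y-new k =
          solve 4 (λ x m c X → x :* (m :* c) :* X := x :* m :* (c :* X)) refl
                (x (a ↑ˡ 1)) (M (a ↑ˡ T) (N ↑ʳ k)) (c k) X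

        new-old-term : ∀ k b → X * (c k * M (N ↑ʳ k) (b ↑ˡ T)) * x (b ↑ˡ 1)
                             ≡ y (N ↑ʳ k) * M (N ↑ʳ k) (b ↑ˡ T) * y (b ↑ˡ T)
        new-old-term k b rewrite y-old b | y-new k =
          solve 4 (λ X c m x → X :* (c :* m) :* x := c :* X :* m :* x) refl
                X (c k) (M (N ↑ʳ k) (b ↑ˡ T)) (x (b ↑ˡ 1))

        new-new-term : ∀ k l → X * (c k * M (N ↑ʳ k) (N ↑ʳ l) * c l) * X
                             ≡ y (N ↑ʳ k) * M (N ↑ʳ k) (N ↑ʳ l) * y (N ↑ʳ l)
        new-new-term k l rewrite y-new k | y-new l =
          solve 4 (λ X c m c′ → X :* (c :* m :* c′) :* X := c :* X :* m :* (c′ :* X)) refl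
                X (c k) (M (N ↑ʳ k) (N ↑ʳ l)) (c l)

        old-new-row : ∀ a → sum (λ l → x (a ↑ˡ 1) * M′ (a ↑ˡ 1) (N ↑ʳ l) * x (N ↑ʳ l))
                          ≡ sum (λ k → y (a ↑ˡ T) * M (a ↑ˡ T) (N ↑ʳ k) * y (N ↑ʳ k))
        old-new-row a = begin
          x (a ↑ˡ 1) * M′ (a ↑ˡ 1) (N ↑ʳ zero) * X + 0ℚ
            ≡⟨ ℚ.+-identityʳ _ ⟩
          x (a ↑ˡ 1) * M′ (a ↑ˡ 1) (N ↑ʳ zero) * X
            ≡⟨ cong (λ z → x (a ↑ˡ 1) * z * X) (old-new a) ⟩
          x (a ↑ˡ 1) * sum (λ k → M (a ↑ˡ T) (N ↑ʳ k) * c k) * X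
            ≡⟨ ℚΣ.*-distrib-sum (x (a ↑ˡ 1)) (λ k → M (a ↑ˡ T) (N ↑ʳ k) * c k) X ⟩
          sum (λ k → x (a ↑ˡ 1) * (M (a ↑ˡ T) (N ↑ʳ k) * c k) * X)
            ≡⟨ sum-cong-≗ (old-new-term a) ⟩
          sum (λ k → y (a ↑ˡ T) * M (a ↑ˡ T) (N ↑ʳ k) * y (N ↑ʳ k)) ∎

        new-old-block : sum (λ k → sum (λ b → x (N ↑ʳ k) * M′ (N ↑ʳ k) (b ↑ˡ 1) * x (b ↑ˡ 1)))
                      ≡ sum (λ k → sum (λ b → y (N ↑ʳ k) * M (N ↑ʳ k) (b ↑ˡ T) * y (b ↑ˡ T)))
        new-old-block = begin
          sum (λ b → X * M′ (N ↑ʳ zero) (b ↑ˡ 1) * x (b ↑ˡ 1)) + 0ℚ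
            ≡⟨ ℚ.+-identityʳ _ ⟩
          sum (λ b → X * M′ (N ↑ʳ zero) (b ↑ˡ 1) * x (b ↑ˡ 1))
            ≡⟨ sum-cong-≗ (λ b → cong (λ z → X * z * x (b ↑ˡ 1)) (new-old b)) ⟩
          sum (λ b → X * sum (λ k → c k * M (N ↑ʳ k) (b ↑ˡ T)) * x (b ↑ˡ 1))
            ≡⟨ sum-cong-≗ (λ b → ℚΣ.*-distrib-sum X (λ k → c k * M (N ↑ʳ k) (b ↑ˡ T)) (x (b ↑ˡ 1))) ⟩
          sum (λ b → sum (λ k → X * (c k * M (N ↑ʳ k) (b ↑ˡ T)) * x (b ↑ˡ 1)))
            ≡⟨ ℚΣ.∑-comm (λ b k → X * (c k * M (N ↑ʳ k) (b ↑ˡ T)) * x (b ↑ˡ 1)) ⟩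
          sum (λ k → sum (λ b → X * (c k * M (N ↑ʳ k) (b ↑ˡ T)) * x (b ↑ˡ 1)))
            ≡⟨ sum-cong-≗ (λ k → sum-cong-≗ (new-old-term k)) ⟩
          sum (λ k → sum (λ b → y (N ↑ʳ k) * M (N ↑ʳ k) (b ↑ˡ T) * y (b ↑ˡ T))) ∎

        new-new-block : sum (λ k → sum (λ l → x (N ↑ʳ k) * M′ (N ↑ʳ k) (N ↑ʳ l) * x (N ↑ʳ l)))
                      ≡ sum (λ k → sum (λ l → y (N ↑ʳ k) * M (N ↑ʳ k) (N ↑ʳ l) * y (N ↑ʳ l)))
        new-new-block = begin
          X * M′ (N ↑ʳ zero) (N ↑ʳ zero) * X + 0ℚ + 0ℚ
            ≡⟨ trans (ℚ.+-identityʳ _) (ℚ.+-identityʳ _) ⟩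
          X * M′ (N ↑ʳ zero) (N ↑ʳ zero) * X
            ≡⟨ cong (λ z → X * z * X) new-new ⟩
          X * sum (λ k → sum (λ l → c k * M (N ↑ʳ k) (N ↑ʳ l) * c l)) * X
            ≡⟨ ℚΣ.*-distrib-sum X (λ k → sum (λ l → c k * M (N ↑ʳ k) (N ↑ʳ l) * c l)) X ⟩
          sum (λ k → X * sum (λ l → c k * M (N ↑ʳ k) (N ↑ʳ l) * c l) * X)
            ≡⟨ sum-cong-≗ (λ k → ℚΣ.*-distrib-sum X (λ l → c k * M (N ↑ʳ k) (N ↑ʳ l) * c l) X) ⟩
          sum (λ k → sum (λ l → X * (c k * M (N ↑ʳ k) (N ↑ʳ l) * c l) * X))
            ≡⟨ sum-cong-≗ (λ k → sum-cong-≗ (new-new-term k)) ⟩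
          sum (λ k → sum (λ l → y (N ↑ʳ k) * M (N ↑ʳ k) (N ↑ʳ l) * y (N ↑ʳ l))) ∎

      quadratic-contraction : quadratic M′ x ≡ quadratic M (expand x)
      quadratic-contraction = begin
        quadratic M′ x
          ≡⟨ ℚΣ.sum²-↑ N (λ p q → x p * M′ p q * x q) ⟩
        _ ≡⟨ cong₂ _+_ (cong₂ _+_ (sum-cong-≗ (λ a → sum-cong-≗ (old-old-term a))) new-old-block)
                       (cong₂ _+_ (sum-cong-≗ old-new-row) new-new-block) ⟩
        _ ≡⟨ ℚΣ.sum²-↑ N (λ u v → y u * M u v * y v) ⟨
        quadratic M y ∎

    module _ {M M′} (C : IsContraction M M′) where
      open IsContraction C

      contraction-symmetric : IsSymmetric M → IsSymmetric M′
      contraction-symmetric M-sym p q with split N p | split N q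
      ... | inˡ a    | inˡ b    = trans (old-old a b) (trans (M-sym _ _) (sym (old-old b a)))
      ... | inˡ a    | inʳ zero = trans (old-new a) (trans (sum-cong-≗ (transposed a)) (sym (new-old a)))
        where transposed : ∀ a k → M (a ↑ˡ T) (N ↑ʳ k) * c k ≡ c k * M (N ↑ʳ k) (a ↑ˡ T)
              transposed a k = trans (cong (_* c k) (M-sym _ _)) (ℚ.*-comm _ (c k))
      ... | inʳ zero | inˡ b    = trans (new-old b) (trans (sum-cong-≗ (transposed b)) (sym (old-new b)))
        where transposed : ∀ b k → c k * M (N ↑ʳ k) (b ↑ˡ T) ≡ M (b ↑ˡ T) (N ↑ʳ k) * c k
              transposed b k = trans (ℚ.*-comm (c k) _) (cong (_* c k) (M-sym _ _))
      ... | inʳ zero | inʳ zero = refl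

      contraction-positiveDefinite : ∀ k → c k ≢ 0ℚ → PositiveDefinite M → PositiveDefinite M′
      contraction-positiveDefinite k ck≢0 M-pd x x≢0 = subst (0ℚ <_) sums-agree (M-pd (expand x) (expand-≢0 x≢0))
        where
        sums-agree : sumℚ (λ a → sumℚ (λ b → expand x a * M a b * expand x b))
                   ≡ sumℚ (λ a → sumℚ (λ b → x a * M′ a b * x b))
        sums-agree = trans (sumℚ²≡quadratic M (expand x))
                     (trans (sym (quadratic-contraction C x)) (sym (sumℚ²≡quadratic M′ x)))
        expand-≢0 : (∃ λ p → x p ≢ 0ℚ) → ∃ λ u → expand x u ≢ 0ℚ
        expand-≢0 (p , xp≢0) with split N p
        ... | inˡ a    = a ↑ˡ T , xp≢0 ∘ trans (sym (lookup-++ˡ (x ∘ (_↑ˡ 1)) (λ k → c k * x (N ↑ʳ zero)) a))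
        ... | inʳ zero = N ↑ʳ k , *-≢0 ck≢0 xp≢0 ∘ trans (sym (lookup-++ʳ (x ∘ (_↑ˡ 1)) (λ k → c k * x (N ↑ʳ zero)) k))

-- Diagrams

module _ where
  open import Data.Integer using (_*_)

  RealisesWeights : (Γ : EWGraph) → Matrix (n Γ) → Set
  RealisesWeights Γ A = ∀ a b → a ≢ b → (weight Γ a b ≡ 0 → A a b ≡ 0ℤ) × (A a b * A b a ≡ + weight Γ a b)

  -- Γ is the diagram of A, with the signs of A itself, as soon as A has the zero pattern and the
  -- weights of Γ.
  signsOf : ∀ {m} → Matrix m → Fin m → Fin m → Sign
  signsOf A a b = Sign.opposite (sign (A a b))

  module _ {Γ : EWGraph} {A : Matrix (n Γ)} (R : RealisesWeights Γ A) where

    private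
      weight≡0 : ∀ {a b} (a≢b : a ≢ b) → A a b ≡ 0ℤ → weight Γ a b ≡ 0
      weight≡0 {a} {b} a≢b Aab≡0 =
        ℤ.+-injective (trans (sym (proj₂ (R a b a≢b))) (trans (cong (_* A b a) Aab≡0) (ℤ.*-zeroˡ (A b a))))

      transpose≡0 : ∀ {a b} (a≢b : a ≢ b) → A a b ≡ 0ℤ → A b a ≡ 0ℤ
      transpose≡0 {a} {b} a≢b Aab≡0 = proj₁ (R b a (a≢b ∘ sym)) (trans (Defs.sym Γ b a) (weight≡0 a≢b Aab≡0))

    signsOf-sym : ∀ a b → signsOf A a b ≡ signsOf A b a
    signsOf-sym a b with a ≟ b
    ... | yes refl = refl
    ... | no a≢b   = cong (Sign.opposite) (*≡+⇒sign≡ (A a b) (A b a) (proj₂ (R a b a≢b))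
                                            (transpose≡0 a≢b) (transpose≡0 (a≢b ∘ sym)))

    realisesWeights⇒diagram : IsDiagramOf Γ (signsOf A , signsOf-sym) A
    realisesWeights⇒diagram a b a≢b =
      mk⇔ (λ Aab≢0 w≡0 → Aab≢0 (proj₁ (R a b a≢b) w≡0)) (λ w≢0 Aab≡0 → w≢0 (weight≡0 a≢b Aab≡0))
      , proj₂ (R a b a≢b)
      , λ _ → refl

  positive⇒realisesWeights : ∀ Γ → IsPositive Γ → ∃ λ A → IsPositiveQuasiCartan A × RealisesWeights Γ A
  positive⇒realisesWeights Γ (_ , A , positiveA , diagramA) = A , positiveA , λ a b a≢b →
    (λ w≡0 → decidable-stable (A a b ℤ.≟ 0ℤ)
                (λ Aab≢0 → Equivalence.to (proj₁ (diagramA a b a≢b)) Aab≢0 w≡0))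
    , proj₁ (proj₂ (diagramA a b a≢b))

  realisesWeights⇒positive : ∀ Γ {A} → IsPositiveQuasiCartan A → RealisesWeights Γ A → IsPositive Γ
  realisesWeights⇒positive Γ {A} positiveA R =
    (signsOf A , signsOf-sym {Γ} R) , A , positiveA , realisesWeights⇒diagram {Γ} R

-- The weights of Γ[i,j;t]

module _ (Γ : EWGraph) (i j : Fin (n Γ)) (s : ℕ) where

  extWeight-old-old : ∀ a b → extWeight Γ i j s (a ↑ˡ suc s) (b ↑ˡ suc s) ≡ weight Γ a b
  extWeight-old-old a b rewrite splitAt-↑ˡ (n Γ) a (suc s) | splitAt-↑ˡ (n Γ) b (suc s) = refl

  extWeight-old-new : ∀ a k → extWeight Γ i j s (a ↑ˡ suc s) (n Γ ↑ʳ k) ≡ oldNew i j a k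
  extWeight-old-new a k rewrite splitAt-↑ˡ (n Γ) a (suc s) | splitAt-↑ʳ (n Γ) (suc s) k = refl

  extWeight-new-old : ∀ k a → extWeight Γ i j s (n Γ ↑ʳ k) (a ↑ˡ suc s) ≡ oldNew i j a k
  extWeight-new-old k a rewrite splitAt-↑ˡ (n Γ) a (suc s) | splitAt-↑ʳ (n Γ) (suc s) k = refl

  extWeight-new-new : ∀ k l → extWeight Γ i j s (n Γ ↑ʳ k) (n Γ ↑ʳ l) ≡ newNew k l
  extWeight-new-new k l rewrite splitAt-↑ʳ (n Γ) (suc s) k | splitAt-↑ʳ (n Γ) (suc s) l = refl

newNew-adjacent : ∀ {s} (k l : Fin (suc s)) → toℕ l ≡ suc (toℕ k) → newNew k l ≡ 1
newNew-adjacent k l l≡1+k with toℕ l ℕ.≡ᵇ suc (toℕ k) in l≡ᵇ1+k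
... | true  = refl
... | false = ⊥-elim (subst Bool.T l≡ᵇ1+k (ℕ.≡⇒≡ᵇ (toℕ l) (suc (toℕ k)) l≡1+k))

newNew-nonadjacent : ∀ {s} (k l : Fin (suc s)) → toℕ l ≢ suc (toℕ k) → toℕ k ≢ suc (toℕ l) → newNew k l ≡ 0
newNew-nonadjacent k l l≢1+k k≢1+l
  with toℕ l ℕ.≡ᵇ suc (toℕ k) in l≡ᵇ1+k | toℕ k ℕ.≡ᵇ suc (toℕ l) in k≡ᵇ1+l
... | true  | _     = contradiction (ℕ.≡ᵇ⇒≡ (toℕ l) (suc (toℕ k)) (subst Bool.T (sym l≡ᵇ1+k) _)) l≢1+k
... | false | true  = contradiction (ℕ.≡ᵇ⇒≡ (toℕ k) (suc (toℕ l)) (subst Bool.T (sym k≡ᵇ1+l) _)) k≢1+l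
... | false | false = refl

module _ {m} {i j : Fin m} (i≢j : i ≢ j) where

  oldNew-first : ∀ {s} → oldNew {s = s} i j i zero ≡ 1
  oldNew-first rewrite proj₂ (dec-yes (i ≟ i) refl) = refl

  oldNew-first-only : ∀ {s} l → oldNew {s = s} i j i (suc l) ≡ 0
  oldNew-first-only l rewrite proj₂ (dec-yes (i ≟ i) refl) | dec-no (i ≟ j) i≢j = refl

  oldNew-last : ∀ {s} → oldNew {s = s} i j j (fromℕ s) ≡ 1
  oldNew-last {s}
    rewrite dec-no (j ≟ i) (i≢j ∘ sym) | proj₂ (dec-yes (j ≟ j) refl)
          | proj₂ (dec-yes (fromℕ s ≟ fromℕ s) refl) = refl

  oldNew-last-only : ∀ {s} l → l ≢ fromℕ s → oldNew {s = s} i j j l ≡ 0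
  oldNew-last-only {s} l l≢last
    rewrite dec-no (j ≟ i) (i≢j ∘ sym) | proj₂ (dec-yes (j ≟ j) refl) | dec-no (l ≟ fromℕ s) l≢last = refl

  oldNew-unattached : ∀ {s a} l → a ≢ i → a ≢ j → oldNew {s = s} i j a l ≡ 0
  oldNew-unattached {a = a} l a≢i a≢j rewrite dec-no (a ≟ i) a≢i | dec-no (a ≟ j) a≢j = refl

  Attachment : ℕ → Fin m → Set
  Attachment s a = ∃ λ k → (∀ l → l ≢ k → oldNew {s = s} i j a l ≡ 0)
                          × oldNew {s = s} i j a k ≡ oldNew {s = 0} i j a zero

  attachment : ∀ {s} a → Attachment s a
  attachment {s} a = byCases (a ≟ i) (a ≟ j)
    where
    byCases : Dec (a ≡ i) → Dec (a ≡ j) → Attachment s a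
    byCases (yes refl) _          = zero
                                  , (λ { zero 0≢0 → contradiction refl 0≢0 ; (suc l) _ → oldNew-first-only l })
                                  , trans oldNew-first (sym (oldNew-first {s = 0}))
    byCases (no _)     (yes refl) = fromℕ s
                                  , oldNew-last-only
                                  , trans oldNew-last (sym (oldNew-last {s = 0}))
    byCases (no a≢i)   (no a≢j)   = zero
                                  , (λ l _ → oldNew-unattached l a≢i a≢j)
                                  , trans (oldNew-unattached zero a≢i a≢j) (sym (oldNew-unattached {s = 0} zero a≢i a≢j))

-- Merging the subdivided edge

module PathContraction (Γ : EWGraph) (i j : Fin (n Γ)) (i≢j : i ≢ j) (s : ℕ) (A : Matrix (n Γ ℕ.+ suc s))
  (realises : RealisesWeights (subdivide Γ i j (suc s)) A) (diagonal : ∀ p → A p p ≡ + 2) where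

  open import Data.Integer using (_*_)

  private
    N T : ℕ
    N = n Γ
    T = suc s

    old : Fin N → Fin (N ℕ.+ T)
    old a = a ↑ˡ T

    new : Fin T → Fin (N ℕ.+ T)
    new k = N ↑ʳ k

    new-injective : ∀ {k l} → k ≢ l → new k ≢ new l
    new-injective k≢l = k≢l ∘ ↑ʳ-injective N _ _

    pathBlock : Fin T → Fin T → ℤ
    pathBlock k l = A (new k) (new l)

    pathBlock-path : IsSimplyLacedPath pathBlock
    pathBlock-path = record
      { diagonal    = diagonal ∘ new
      ; adjacent    = λ k l l≡1+k → trans (proj₂ (realises (new k) (new l) (new-injective (k≢l l≡1+k))))
                                          (cong +_ (trans (extWeight-new-new Γ i j s k l) (newNew-adjacent k l l≡1+k)))
      ; nonadjacent = λ k l k≢l l≢1+k k≢1+l → proj₁ (realises (new k) (new l) (new-injective k≢l))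
                                          (trans (extWeight-new-new Γ i j s k l) (newNew-nonadjacent k l l≢1+k k≢1+l))
      }
      where
      k≢l : ∀ {k l : Fin T} → toℕ l ≡ suc (toℕ k) → k ≢ l
      k≢l l≡1+k refl = ℕ.1+n≢n (sym l≡1+k)

    c : Fin T → ℤ
    c = pathSigns pathBlock

    toNew fromNew : Fin N → ℤ
    toNew   a = ℤΣ.sum (λ k → A (old a) (new k) * c k)
    fromNew b = ℤΣ.sum (λ k → c k * A (new k) (old b))

    module A′-Blocks = Blocks {N} {1} (λ a b → A (old a) (old b)) (λ a _ → toNew a) (λ _ b → fromNew b) (λ _ _ → + 2)

  A′ : Matrix (N ℕ.+ 1)
  A′ = A′-Blocks.blocks

  private
    A′-old-old : ∀ a b → A′ (a ↑ˡ 1) (b ↑ˡ 1) ≡ A (old a) (old b)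
    A′-old-old = A′-Blocks.blocks-↑ˡ-↑ˡ

    A′-old-new : ∀ a → A′ (a ↑ˡ 1) (N ↑ʳ zero) ≡ toNew a
    A′-old-new a = A′-Blocks.blocks-↑ˡ-↑ʳ a zero

    A′-new-old : ∀ b → A′ (N ↑ʳ zero) (b ↑ˡ 1) ≡ fromNew b
    A′-new-old = A′-Blocks.blocks-↑ʳ-↑ˡ zero

    A′-new-new : A′ (N ↑ʳ zero) (N ↑ʳ zero) ≡ + 2
    A′-new-new = A′-Blocks.blocks-↑ʳ-↑ʳ zero zero

    weight₁ : Fin N → ℕ
    weight₁ a = oldNew {s = 0} i j a zero

  attached-entries : ∀ a → (weight₁ a ≡ 0 → toNew a ≡ 0ℤ) × (weight₁ a ≡ 0 → fromNew a ≡ 0ℤ)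
                         × (toNew a * fromNew a ≡ + weight₁ a)
  attached-entries a with attachment i≢j {s} a
  ... | k , unattached , wₖ≡w = (λ w≡0 → trans toNew≡ (cong (_* c k) (A-old-new≡0 k (trans wₖ≡w w≡0))))
                               , (λ w≡0 → trans fromNew≡ (trans (cong (c k *_) (A-new-old≡0 k (trans wₖ≡w w≡0)))
                                                                (ℤ.*-zeroʳ (c k))))
                               , product
    where
    A-old-new≡0 : ∀ l → oldNew i j a l ≡ 0 → A (old a) (new l) ≡ 0ℤ
    A-old-new≡0 l w≡0 = proj₁ (realises (old a) (new l) (↑ˡ≢↑ʳ a l)) (trans (extWeight-old-new Γ i j s a l) w≡0)

    A-new-old≡0 : ∀ l → oldNew i j a l ≡ 0 → A (new l) (old a) ≡ 0ℤ
    A-new-old≡0 l w≡0 = proj₁ (realises (new l) (old a) (↑ˡ≢↑ʳ a l ∘ sym)) (trans (extWeight-new-old Γ i j s l a) w≡0)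

    toNew≡ : toNew a ≡ A (old a) (new k) * c k
    toNew≡ = ℤΣ.sum-single (λ l → A (old a) (new l) * c l) k
               (λ l l≢k → cong (_* c l) (A-old-new≡0 l (unattached l l≢k)))

    fromNew≡ : fromNew a ≡ c k * A (new k) (old a)
    fromNew≡ = ℤΣ.sum-single (λ l → c l * A (new l) (old a)) k
                 (λ l l≢k → trans (cong (c l *_) (A-new-old≡0 l (unattached l l≢k))) (ℤ.*-zeroʳ (c l)))

    product : toNew a * fromNew a ≡ + weight₁ a
    product = begin
      toNew a * fromNew a                                    ≡⟨ cong₂ _*_ toNew≡ fromNew≡ ⟩
      A (old a) (new k) * c k * (c k * A (new k) (old a))    ≡⟨ regroup (A (old a) (new k)) (A (new k) (old a)) (c k) ⟩
      A (old a) (new k) * A (new k) (old a) * (c k * c k)    ≡⟨ cong₂ _*_ (proj₂ (realises (old a) (new k) (↑ˡ≢↑ʳ a k)))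
                                                                         (pathSigns-square pathBlock-path k) ⟩
      + extWeight Γ i j s (old a) (new k) * 1ℤ               ≡⟨ ℤ.*-identityʳ _ ⟩
      + extWeight Γ i j s (old a) (new k)                    ≡⟨ cong +_ (trans (extWeight-old-new Γ i j s a k) wₖ≡w) ⟩
      + weight₁ a                                            ∎
      where
      open ≡-Reasoning
      regroup : ∀ x y z → x * z * (z * y) ≡ x * y * (z * z)
      regroup = solve-∀

  A′-diagonal : ∀ p → A′ p p ≡ + 2
  A′-diagonal p with split N p
  ... | inˡ a    = trans (A′-old-old a a) (diagonal (old a))
  ... | inʳ zero = A′-new-new

  A′-realises : RealisesWeights (subdivide Γ i j 1) A′
  A′-realises p q p≢q with split N p | split N q
  ... | inˡ a    | inˡ b    rewrite A′-old-old a b | A′-old-old b a | extWeight-old-old Γ i j 0 a b =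
    subst (λ w → (w ≡ 0 → _) × (_ ≡ + w)) (extWeight-old-old Γ i j s a b)
          (realises (old a) (old b) (p≢q ∘ cong (_↑ˡ 1) ∘ ↑ˡ-injective T a b))
  ... | inˡ a    | inʳ zero rewrite A′-old-new a | A′-new-old a | extWeight-old-new Γ i j 0 a zero =
    let toNew≡0 , _ , product = attached-entries a in toNew≡0 , product
  ... | inʳ zero | inˡ a    rewrite A′-old-new a | A′-new-old a | extWeight-new-old Γ i j 0 zero a =
    let _ , fromNew≡0 , product = attached-entries a in fromNew≡0 , trans (ℤ.*-comm (fromNew a) (toNew a)) product
  ... | inʳ zero | inʳ zero = contradiction refl p≢q

  module _ (d : Fin (N ℕ.+ T) → ℚ) (dA-sym : IsSymmetric (diagMul d A)) where

    private
      d₀ : ℚ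
      d₀ = d (new zero)

    d′ : Fin (N ℕ.+ 1) → ℚ
    d′ = (λ a → d (old a)) ++ (λ _ → d₀)

    private
      open ≡-Reasoning
      open ℚΣ using (sum; sum-cong-≗)

      d′-old : ∀ a → d′ (a ↑ˡ 1) ≡ d (old a)
      d′-old = lookup-++ˡ (λ a → d (old a)) (λ _ → d₀)

      d′-new : d′ (N ↑ʳ zero) ≡ d₀
      d′-new = lookup-++ʳ (λ a → d (old a)) (λ _ → d₀) zero

      d-new : ∀ k → d (new k) ≡ d₀
      d-new = symmetrizer-path-constant pathBlock-path (d ∘ new) (λ k l → dA-sym (new k) (new l))

      scaled-fromℤ-sum : ∀ {m} e (g : Fin m → ℤ) → e ℚ.* fromℤ (ℤΣ.sum g) ≡ sum (λ k → e ℚ.* fromℤ (g k))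
      scaled-fromℤ-sum e g = trans (cong (e ℚ.*_) (fromℤ-sum g)) (ℚΣ.*-distribˡ-sum e (fromℤ ∘ g))

      d′A′-old-new : ∀ a → diagMul d′ A′ (a ↑ˡ 1) (N ↑ʳ zero)
                         ≡ sum (λ k → diagMul d A (old a) (new k) ℚ.* fromℤ (c k))
      d′A′-old-new a = begin
        d′ (a ↑ˡ 1) ℚ.* fromℤ (A′ (a ↑ˡ 1) (N ↑ʳ zero))
          ≡⟨ cong₂ ℚ._*_ (d′-old a) (cong fromℤ (A′-old-new a)) ⟩
        d (old a) ℚ.* fromℤ (toNew a)
          ≡⟨ scaled-fromℤ-sum (d (old a)) (λ k → A (old a) (new k) * c k) ⟩
        sum (λ k → d (old a) ℚ.* fromℤ (A (old a) (new k) * c k))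
          ≡⟨ sum-cong-≗ (λ k → trans (cong (d (old a) ℚ.*_) (fromℤ-* (A (old a) (new k)) (c k)))
                                      (sym (ℚ.*-assoc (d (old a)) (fromℤ (A (old a) (new k))) (fromℤ (c k))))) ⟩
        sum (λ k → diagMul d A (old a) (new k) ℚ.* fromℤ (c k)) ∎

      d′A′-new-old : ∀ b → diagMul d′ A′ (N ↑ʳ zero) (b ↑ˡ 1)
                         ≡ sum (λ k → fromℤ (c k) ℚ.* diagMul d A (new k) (old b))
      d′A′-new-old b = begin
        d′ (N ↑ʳ zero) ℚ.* fromℤ (A′ (N ↑ʳ zero) (b ↑ˡ 1))
          ≡⟨ cong₂ ℚ._*_ d′-new (cong fromℤ (A′-new-old b)) ⟩
        d₀ ℚ.* fromℤ (fromNew b)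
          ≡⟨ scaled-fromℤ-sum d₀ (λ k → c k * A (new k) (old b)) ⟩
        sum (λ k → d₀ ℚ.* fromℤ (c k * A (new k) (old b)))
          ≡⟨ sum-cong-≗ term ⟩
        sum (λ k → fromℤ (c k) ℚ.* diagMul d A (new k) (old b)) ∎
        where
        term : ∀ k → d₀ ℚ.* fromℤ (c k * A (new k) (old b)) ≡ fromℤ (c k) ℚ.* diagMul d A (new k) (old b)
        term k rewrite fromℤ-* (c k) (A (new k) (old b)) | d-new k =
          solve 3 (λ d x y → d :* (x :* y) := x :* (d :* y)) refl d₀ (fromℤ (c k)) (fromℤ (A (new k) (old b)))

      d′A′-new-new : diagMul d′ A′ (N ↑ʳ zero) (N ↑ʳ zero)
                   ≡ sum (λ k → sum (λ l → fromℤ (c k) ℚ.* diagMul d A (new k) (new l) ℚ.* fromℤ (c l)))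
      d′A′-new-new = begin
        d′ (N ↑ʳ zero) ℚ.* fromℤ (A′ (N ↑ʳ zero) (N ↑ʳ zero))
          ≡⟨ cong₂ ℚ._*_ d′-new (cong fromℤ (trans A′-new-new (sym (pathQuadratic≡2 pathBlock-path)))) ⟩
        d₀ ℚ.* fromℤ (pathQuadratic pathBlock)
          ≡⟨ scaled-fromℤ-sum d₀ (λ k → ℤΣ.sum (λ l → c k * pathBlock k l * c l)) ⟩
        sum (λ k → d₀ ℚ.* fromℤ (ℤΣ.sum (λ l → c k * pathBlock k l * c l)))
          ≡⟨ sum-cong-≗ (λ k → scaled-fromℤ-sum d₀ (λ l → c k * pathBlock k l * c l)) ⟩
        sum (λ k → sum (λ l → d₀ ℚ.* fromℤ (c k * pathBlock k l * c l)))
          ≡⟨ sum-cong-≗ (λ k → sum-cong-≗ (term k)) ⟩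
        sum (λ k → sum (λ l → fromℤ (c k) ℚ.* diagMul d A (new k) (new l) ℚ.* fromℤ (c l))) ∎
        where
        term : ∀ k l → d₀ ℚ.* fromℤ (c k * pathBlock k l * c l)
                     ≡ fromℤ (c k) ℚ.* diagMul d A (new k) (new l) ℚ.* fromℤ (c l)
        term k l rewrite fromℤ-* (c k * pathBlock k l) (c l) | fromℤ-* (c k) (pathBlock k l) | d-new k =
          solve 4 (λ d x y z → d :* (x :* y :* z) := x :* (d :* y) :* z) refl
                d₀ (fromℤ (c k)) (fromℤ (pathBlock k l)) (fromℤ (c l))

    d′A′-contraction : IsContraction (fromℤ ∘ c) (diagMul d A) (diagMul d′ A′)
    d′A′-contraction = record
      { old-old = λ a b → cong₂ ℚ._*_ (d′-old a) (cong fromℤ (A′-old-old a b))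
      ; old-new = d′A′-old-new
      ; new-old = d′A′-new-old
      ; new-new = d′A′-new-new
      }

    d′-positive : (∀ p → 0ℚ ℚ.< d p) → ∀ p → 0ℚ ℚ.< d′ p
    d′-positive d-pos p with split N p
    ... | inˡ a    = subst (0ℚ ℚ.<_) (sym (d′-old a)) (d-pos (old a))
    ... | inʳ zero = subst (0ℚ ℚ.<_) (sym d′-new) (d-pos (new zero))

  A′-positive : IsPositiveQuasiCartan A → IsPositiveQuasiCartan A′
  A′-positive (_ , d , (d-pos , dA-sym) , dA-pd) =
    A′-diagonal , d′ d dA-sym , (d′-positive d dA-sym d-pos , contraction-symmetric (fromℤ ∘ c) C dA-sym)
    , contraction-positiveDefinite (fromℤ ∘ c) C zero ℚ.1≢0 dA-pd
    where
    C : IsContraction (fromℤ ∘ c) (diagMul d A) (diagMul (d′ d dA-sym) A′)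
    C = d′A′-contraction d dA-sym

lemma3p4 : (Γ : EWGraph) (i j : Fin (n Γ)) → i ≢ j → (t : ℕ) → .{{_ : NonZero t}} →
    IsPositive (subdivide Γ i j t) → IsPositive (subdivide Γ i j 1)
lemma3p4 Γ i j i≢j (suc s) positive =
  let A , positiveA , realisesA = positive⇒realisesWeights (subdivide Γ i j (suc s)) positive
      open PathContraction Γ i j i≢j s A realisesA (proj₁ positiveA)
  in realisesWeights⇒positive (subdivide Γ i j 1) (A′-positive positiveA) A′-realises
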